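{- Let $f:A^*\to\mathbb N$ associate to each word $w$ the maximum length of a strictly decreasing subsequence (subword) of $w$. (i) For $u,v\in A^*$, $u\equiv^l_f v$ if and only if $u\cdot\emptyset=v\cdot\emptyset$, where $\emptyset$ is the empty column. (ii) The syntactic congruence $\equiv_f$ coincides with $\equiv_{styl}$, so the syntactic monoid of $f$ is $\mathrm{Styl}(A)$.
   Context: $A$ is a finite totally ordered alphabet. A column is a subset of $A$, identified with the strictly decreasing word of its elements. For a column $\gamma$ and a letter $x$: if $x>y$ for all $y\in\gamma$, $x\cdot\gamma=\gamma\cup\{x\}$; otherwise with $y$ the smallest element of $\gamma$ with $y\geq x$, $x\cdot\gamma=(\gamma\setminus\{y\})\cup\{x\}$; this extends to a left action of $A^*$ on columns by $(uv)\cdot\gamma=u\cdot(v\cdot\gamma)$. $u\equiv_{styl}v$ iff $u\cdot\gamma=v\cdot\gamma$ for all columns $\gamma$, and $\mathrm{Styl}(A)=A^*/\equiv_{styl}$. For a function $f$ on $A^*$, the syntactic congruence is $u\equiv_f v$ iff $f(xuy)=f(xvy)$ for all $x,y\in A^*$, the syntactic monoid is $A^*/\equiv_f$, and the left syntactic congruence is $u\equiv^l_f v$ iff $f(xu)=f(xv)$ for all $x\in A^*$. -}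

module Defs where

open import Data.Bool using (Bool; true; false; _∧_; if_then_else_)
open import Data.Nat using (ℕ; zero; suc; _⊔_; _<ᵇ_; _≤ᵇ_)
open import Data.Fin using (Fin; toℕ)
open import Data.Fin.Subset using (Subset; ⊥; inside; outside)
open import Data.List using (List; []; _∷_; _++_; map; length; foldr; filterᵇ; allFin; head)
open import Data.Vec using (lookup; _[_]≔_)
open import Data.Maybe using (Maybe; just; nothing)
open import Relation.Binary.PropositionalEquality using (_≡_)
open import Data.Product using (_×_)

-- Alphabet: A = Fin n with its natural total order (an arbitrary finite totally ordered set).
-- Words: List (Fin n). Columns: subsets of A, as Data.Fin.Subset.

mem : ∀ {n} → Fin n → Subset n → Bool
mem y γ with lookup γ y
... | inside  = true
... | outside = false

-- smallest element y of γ with y ≥ x (allFin n is listed in increasing order)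
smallestAbove : ∀ {n} → Fin n → Subset n → Maybe (Fin n)
smallestAbove {n} x γ = head (filterᵇ (λ y → (toℕ x ≤ᵇ toℕ y) ∧ mem y γ) (allFin n))

act : ∀ {n} → Fin n → Subset n → Subset n
act x γ with smallestAbove x γ
... | nothing = γ [ x ]≔ inside
... | just y  = (γ [ y ]≔ outside) [ x ]≔ inside

actW : ∀ {n} → List (Fin n) → Subset n → Subset n
actW []      γ = γ
actW (x ∷ w) γ = act x (actW w γ)

∅col : ∀ {n} → Subset n
∅col = ⊥

_≡styl_ : ∀ {n} → List (Fin n) → List (Fin n) → Set
u ≡styl v = ∀ γ → actW u γ ≡ actW v γ

subwords : ∀ {a} {X : Set a} → List X → List (List X)
subwords []       = [] ∷ []
subwords (x ∷ xs) = map (x ∷_) (subwords xs) ++ subwords xs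

strictDec : ∀ {n} → List (Fin n) → Bool
strictDec []           = true
strictDec (x ∷ [])     = true
strictDec (x ∷ y ∷ ys) = (toℕ y <ᵇ toℕ x) ∧ strictDec (y ∷ ys)

maxList : List ℕ → ℕ
maxList = foldr _⊔_ 0

f : ∀ {n} → List (Fin n) → ℕ
f w = maxList (map length (filterᵇ strictDec (subwords w)))

SynCong : ∀ {n} → (List (Fin n) → ℕ) → List (Fin n) → List (Fin n) → Set
SynCong g u v = ∀ x y → g (x ++ u ++ y) ≡ g (x ++ v ++ y)

LeftSynCong : ∀ {n} → (List (Fin n) → ℕ) → List (Fin n) → List (Fin n) → Set
LeftSynCong g u v = ∀ x → g (x ++ u) ≡ g (x ++ v)

module Submission where

-- Let maxDecreasingBelow w s be the length of a longest strictly decreasing subword of w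
-- with letters < s, and countBelow γ s the number of elements of the column γ below s.
-- As functions of s both obey the same recursion in the first letter of w, so
-- maxDecreasingBelow w = countBelow (w · ∅); in particular f w only depends on w · ∅.
-- Prefixing u by the word (n − 1)⋯t turns f into (n − t) + countBelow (u · ∅) t, so the left
-- syntactic class of u determines every count of u · ∅, hence u · ∅ itself.
-- Every column γ is δ · ∅ for its decreasing reading δ, so u · γ = (u δ) · ∅, which reduces
-- the two-sided congruence to the left one.

open import Data.Bool using (Bool; true; false; _∧_; if_then_else_; T; T?)
open import Data.Bool.Properties using (T-≡)
open import Data.Fin using (Fin; zero; suc; toℕ)
open import Data.Fin.Properties using (toℕ<n)
open import Data.Fin.Subset using (Subset; inside; outside)
open import Data.List using (List; []; _∷_; _++_; _∷ʳ_; map; length; filterᵇ; allFin; head; tabulate)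
open import Data.List.Properties using (map-++; map-∘; map-tabulate; head-map; filter-++; filter-none; filter-reject; filter-≐; ++-assoc)
open import Data.List.Relation.Unary.All using (universal)
open import Data.Maybe using (Maybe; just; nothing)
import Data.Maybe as Maybe
open import Data.Nat using (ℕ; zero; suc; _⊔_; _∸_; _+_; _<ᵇ_; _≤ᵇ_; pred)
open import Data.Nat.Properties using (⊔-assoc; ⊔-identityʳ; +-cancelˡ-≡; +-suc; <⇒<ᵇ)
open import Data.Product using (_×_; _,_; ∃)
open import Data.Vec using (_∷_; []; _[_]≔_)
open import Function using (_∘_; id; _⇔_; mk⇔; Equivalence)
open import Relation.Binary.PropositionalEquality
open ≡-Reasoning

open import Defs

maxList-++ : ∀ ks ls → maxList (ks ++ ls) ≡ maxList ks ⊔ maxList ls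
maxList-++ []       ls = refl
maxList-++ (k ∷ ks) ls = trans (cong (k ⊔_) (maxList-++ ks ls)) (sym (⊔-assoc k _ _))

maxList-map-suc-∷ʳ : ∀ ks k → maxList (map suc (ks ∷ʳ k)) ≡ suc (maxList (ks ∷ʳ k))
maxList-map-suc-∷ʳ []       k = cong suc (sym (⊔-identityʳ k))
maxList-map-suc-∷ʳ (k′ ∷ ks) k = cong (suc k′ ⊔_) (maxList-map-suc-∷ʳ ks k)

module _ {A B : Set} where

  filterᵇ-map : (p : B → Bool) (g : A → B) (xs : List A) →
                filterᵇ p (map g xs) ≡ map g (filterᵇ (p ∘ g) xs)
  filterᵇ-map p g []       = refl
  filterᵇ-map p g (x ∷ xs) with p (g x)
  ... | true  = cong (g x ∷_) (filterᵇ-map p g xs)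
  ... | false = filterᵇ-map p g xs

module _ {A : Set} where

  filterᵇ-cong : {p q : A → Bool} → (∀ x → p x ≡ q x) → (xs : List A) → filterᵇ p xs ≡ filterᵇ q xs
  filterᵇ-cong {p} {q} p≗q =
    filter-≐ (T? ∘ p) (T? ∘ q) ((λ {x} → subst T (p≗q x)) , (λ {x} → subst T (sym (p≗q x))))

  filterᵇ-false : (xs : List A) → filterᵇ (λ _ → false) xs ≡ []
  filterᵇ-false xs = filter-none (λ _ → T? false) (universal (λ _ ()) xs)

  subwords-∷ʳ-[] : (w : List A) → ∃ λ ws → subwords w ≡ ws ∷ʳ []
  subwords-∷ʳ-[] []      = [] , refl
  subwords-∷ʳ-[] (x ∷ w) with subwords-∷ʳ-[] w
  ... | ws , eq = map (x ∷_) (subwords w) ++ ws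
                , trans (cong (map (x ∷_) (subwords w) ++_) eq) (sym (++-assoc (map (x ∷_) (subwords w)) ws _))

-- A longest decreasing subword of x w below s either starts with x, possible only when x < s,
-- or is a subword of w.
extend : ℕ → (ℕ → ℕ) → ℕ → ℕ
extend x c s = (if x <ᵇ s then suc (c x) else 0) ⊔ c s

extend-cong : ∀ x {c d : ℕ → ℕ} → (∀ t → c t ≡ d t) → ∀ s → extend x c s ≡ extend x d s
extend-cong x c≗d s = cong₂ (λ a b → (if x <ᵇ s then suc a else 0) ⊔ b) (c≗d x) (c≗d s)

module _ {n : ℕ} where

  decreasingBelow : ℕ → List (Fin n) → Bool
  decreasingBelow s []      = true
  decreasingBelow s (x ∷ z) = (toℕ x <ᵇ s) ∧ decreasingBelow (toℕ x) z

  strictDec-∷ : (x : Fin n) (z : List (Fin n)) → strictDec (x ∷ z) ≡ decreasingBelow (toℕ x) z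
  strictDec-∷ x []      = refl
  strictDec-∷ x (y ∷ z) = cong ((toℕ y <ᵇ toℕ x) ∧_) (strictDec-∷ y z)

  strictDec≡decreasingBelow : (z : List (Fin n)) → strictDec z ≡ decreasingBelow n z
  strictDec≡decreasingBelow []      = refl
  strictDec≡decreasingBelow (x ∷ z) rewrite Equivalence.to T-≡ (<⇒<ᵇ (toℕ<n x)) = strictDec-∷ x z

  maxDecreasingBelow : List (Fin n) → ℕ → ℕ
  maxDecreasingBelow w s = maxList (map length (filterᵇ (decreasingBelow s) (subwords w)))

  f≡maxDecreasingBelow : (w : List (Fin n)) → f w ≡ maxDecreasingBelow w n
  f≡maxDecreasingBelow w =
    cong (maxList ∘ map length) (filterᵇ-cong strictDec≡decreasingBelow (subwords w))

  -- The empty subword keeps the list of lengths nonempty, so that suc commutes with the maximum.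
  maxList-map-suc-lengths : (w : List (Fin n)) (s : ℕ) →
    maxList (map suc (map length (filterᵇ (decreasingBelow s) (subwords w)))) ≡ suc (maxDecreasingBelow w s)
  maxList-map-suc-lengths w s with subwords w | subwords-∷ʳ-[] w
  ... | _ | ws , refl
    rewrite filter-++ (T? ∘ decreasingBelow s) ws ([] ∷ [])
          | map-++ length (filterᵇ (decreasingBelow s) ws) ([] ∷ [])
    = maxList-map-suc-∷ʳ (map length (filterᵇ (decreasingBelow s) ws)) 0

  maxList-lengths-∷ : (x : Fin n) (w : List (Fin n)) (s : ℕ) →
    maxList (map length (filterᵇ (decreasingBelow s) (map (x ∷_) (subwords w))))
      ≡ (if toℕ x <ᵇ s then suc (maxDecreasingBelow w (toℕ x)) else 0)
  maxList-lengths-∷ x w s rewrite filterᵇ-map (decreasingBelow s) (x ∷_) (subwords w) with toℕ x <ᵇ s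
  ... | false = cong (maxList ∘ map length ∘ map (x ∷_)) (filterᵇ-false (subwords w))
  ... | true  = begin
    maxList (map length (map (x ∷_) ws))  ≡⟨ cong maxList (sym (map-∘ ws)) ⟩
    maxList (map (suc ∘ length) ws)       ≡⟨ cong maxList (map-∘ ws) ⟩
    maxList (map suc (map length ws))     ≡⟨ maxList-map-suc-lengths w (toℕ x) ⟩
    suc (maxDecreasingBelow w (toℕ x))    ∎
    where ws = filterᵇ (decreasingBelow (toℕ x)) (subwords w)

  maxDecreasingBelow-∷ : (x : Fin n) (w : List (Fin n)) (s : ℕ) →
    maxDecreasingBelow (x ∷ w) s ≡ extend (toℕ x) (maxDecreasingBelow w) s
  maxDecreasingBelow-∷ x w s = begin
    maxList (map length (filterᵇ P (map (x ∷_) S ++ S)))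
      ≡⟨ cong (maxList ∘ map length) (filter-++ (T? ∘ P) (map (x ∷_) S) S) ⟩
    maxList (map length (filterᵇ P (map (x ∷_) S) ++ filterᵇ P S))
      ≡⟨ cong maxList (map-++ length (filterᵇ P (map (x ∷_) S)) (filterᵇ P S)) ⟩
    maxList (map length (filterᵇ P (map (x ∷_) S)) ++ map length (filterᵇ P S))
      ≡⟨ maxList-++ (map length (filterᵇ P (map (x ∷_) S))) (map length (filterᵇ P S)) ⟩
    maxList (map length (filterᵇ P (map (x ∷_) S))) ⊔ maxDecreasingBelow w s
      ≡⟨ cong (_⊔ maxDecreasingBelow w s) (maxList-lengths-∷ x w s) ⟩
    extend (toℕ x) (maxDecreasingBelow w) s ∎
    where
    P = decreasingBelow s
    S = subwords w

countBelow : ∀ {m} → Subset m → ℕ → ℕ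
countBelow _             zero    = 0
countBelow []            (suc s) = 0
countBelow (inside ∷ γ)  (suc s) = suc (countBelow γ s)
countBelow (outside ∷ γ) (suc s) = countBelow γ s

countBelow-∅ : ∀ {m} s → countBelow (∅col {m}) s ≡ 0
countBelow-∅         zero    = refl
countBelow-∅ {zero}  (suc s) = refl
countBelow-∅ {suc m} (suc s) = countBelow-∅ {m} s

countBelow-injective : ∀ {m} {γ δ : Subset m} → (∀ t → countBelow γ t ≡ countBelow δ t) → γ ≡ δ
countBelow-injective {γ = []}          {[]}          _  = refl
countBelow-injective {γ = inside ∷ γ}  {inside ∷ δ}  eq = cong (inside ∷_) (countBelow-injective (cong pred ∘ eq ∘ suc))
countBelow-injective {γ = outside ∷ γ} {outside ∷ δ} eq = cong (outside ∷_) (countBelow-injective (eq ∘ suc))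
countBelow-injective {γ = inside ∷ γ}  {outside ∷ δ} eq with () ← eq 1
countBelow-injective {γ = outside ∷ γ} {inside ∷ δ}  eq with () ← eq 1

removeMin : ∀ {m} → Subset m → Subset m
removeMin []            = []
removeMin (inside ∷ γ)  = outside ∷ γ
removeMin (outside ∷ γ) = outside ∷ removeMin γ

suc-pred≡1⊔ : ∀ c → suc (pred c) ≡ 1 ⊔ c
suc-pred≡1⊔ zero    = refl
suc-pred≡1⊔ (suc c) = refl

countBelow-removeMin : ∀ {m} (γ : Subset m) s → countBelow (removeMin γ) s ≡ pred (countBelow γ s)
countBelow-removeMin γ             zero    = refl
countBelow-removeMin []            (suc s) = refl
countBelow-removeMin (inside ∷ γ)  (suc s) = refl
countBelow-removeMin (outside ∷ γ) (suc s) = countBelow-removeMin γ s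

smallest : ∀ {m} → Subset m → Maybe (Fin m)
smallest {m} γ = head (filterᵇ (λ y → mem y γ) (allFin m))

remove : ∀ {m} → Maybe (Fin m) → Subset m → Subset m
remove nothing  γ = γ
remove (just y) γ = γ [ y ]≔ outside

remove-map-suc : ∀ {m} (o : Maybe (Fin m)) b (γ : Subset m) → remove (Maybe.map suc o) (b ∷ γ) ≡ b ∷ remove o γ
remove-map-suc nothing  b γ = refl
remove-map-suc (just y) b γ = refl

act≡remove-insert : ∀ {m} (x : Fin m) (γ : Subset m) → act x γ ≡ remove (smallestAbove x γ) γ [ x ]≔ inside
act≡remove-insert x γ with smallestAbove x γ
... | nothing = refl
... | just y  = refl

head-filterᵇ-allFin-suc : ∀ {m} (p : Fin (suc m) → Bool) → p zero ≡ false →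
  head (filterᵇ p (allFin (suc m))) ≡ Maybe.map suc (head (filterᵇ (p ∘ suc) (allFin m)))
head-filterᵇ-allFin-suc {m} p p0≡false = begin
  head (filterᵇ p (zero ∷ tabulate suc))        ≡⟨ cong head (filter-reject (T? ∘ p) (subst T p0≡false)) ⟩
  head (filterᵇ p (tabulate suc))               ≡⟨ cong (head ∘ filterᵇ p) (sym (map-tabulate id suc)) ⟩
  head (filterᵇ p (map suc (allFin m)))         ≡⟨ cong head (filterᵇ-map p suc (allFin m)) ⟩
  head (map suc (filterᵇ (p ∘ suc) (allFin m))) ≡⟨ head-map (filterᵇ (p ∘ suc) (allFin m)) ⟩
  Maybe.map suc (head (filterᵇ (p ∘ suc) (allFin m))) ∎

smallestAbove-suc : ∀ {m} (x : Fin m) b (γ : Subset m) →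
  smallestAbove (suc x) (b ∷ γ) ≡ Maybe.map suc (smallestAbove x γ)
smallestAbove-suc zero    b γ = head-filterᵇ-allFin-suc (λ y → (1 ≤ᵇ toℕ y) ∧ mem y (b ∷ γ)) refl
smallestAbove-suc (suc x) b γ = head-filterᵇ-allFin-suc (λ y → (suc (suc (toℕ x)) ≤ᵇ toℕ y) ∧ mem y (b ∷ γ)) refl

smallest-outside : ∀ {m} (γ : Subset m) → smallest (outside ∷ γ) ≡ Maybe.map suc (smallest γ)
smallest-outside γ = head-filterᵇ-allFin-suc (λ y → mem y (outside ∷ γ)) refl

remove-smallest : ∀ {m} (γ : Subset m) → remove (smallest γ) γ ≡ removeMin γ
remove-smallest []            = refl
remove-smallest (inside ∷ γ)  = refl
remove-smallest (outside ∷ γ) = begin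
  remove (smallest (outside ∷ γ)) (outside ∷ γ)    ≡⟨ cong (λ o → remove o (outside ∷ γ)) (smallest-outside γ) ⟩
  remove (Maybe.map suc (smallest γ)) (outside ∷ γ) ≡⟨ remove-map-suc (smallest γ) outside γ ⟩
  outside ∷ remove (smallest γ) γ                   ≡⟨ cong (outside ∷_) (remove-smallest γ) ⟩
  outside ∷ removeMin γ                             ∎

act-suc : ∀ {m} (x : Fin m) b (γ : Subset m) → act (suc x) (b ∷ γ) ≡ b ∷ act x γ
act-suc x b γ = begin
  act (suc x) (b ∷ γ)                                                ≡⟨ act≡remove-insert (suc x) (b ∷ γ) ⟩
  remove (smallestAbove (suc x) (b ∷ γ)) (b ∷ γ) [ suc x ]≔ inside   ≡⟨ cong (λ o → remove o (b ∷ γ) [ suc x ]≔ inside) (smallestAbove-suc x b γ) ⟩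
  remove (Maybe.map suc (smallestAbove x γ)) (b ∷ γ) [ suc x ]≔ inside ≡⟨ cong (_[ suc x ]≔ inside) (remove-map-suc (smallestAbove x γ) b γ) ⟩
  b ∷ remove (smallestAbove x γ) γ [ x ]≔ inside                     ≡⟨ cong (b ∷_) (act≡remove-insert x γ) ⟨
  b ∷ act x γ                                                        ∎

act-zero-outside : ∀ {m} (γ : Subset m) → act zero (outside ∷ γ) ≡ inside ∷ removeMin γ
act-zero-outside γ = begin
  act zero (outside ∷ γ)                                             ≡⟨ act≡remove-insert zero (outside ∷ γ) ⟩
  remove (smallestAbove zero (outside ∷ γ)) (outside ∷ γ) [ zero ]≔ inside ≡⟨ cong (λ o → remove o (outside ∷ γ) [ zero ]≔ inside) (smallest-outside γ) ⟩
  remove (Maybe.map suc (smallest γ)) (outside ∷ γ) [ zero ]≔ inside ≡⟨ cong (_[ zero ]≔ inside) (remove-map-suc (smallest γ) outside γ) ⟩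
  inside ∷ remove (smallest γ) γ                                     ≡⟨ cong (inside ∷_) (remove-smallest γ) ⟩
  inside ∷ removeMin γ                                               ∎

countBelow-act : ∀ {m} (x : Fin m) (γ : Subset m) s → countBelow (act x γ) s ≡ extend (toℕ x) (countBelow γ) s
countBelow-act x       γ             zero    = refl
countBelow-act zero    (inside ∷ γ)  (suc s) = refl
countBelow-act zero    (outside ∷ γ) (suc s) rewrite act-zero-outside γ | countBelow-removeMin γ s = suc-pred≡1⊔ (countBelow γ s)
countBelow-act (suc x) (inside ∷ γ)  (suc s) rewrite act-suc x inside γ | countBelow-act x γ s with toℕ x <ᵇ s
... | true  = refl
... | false = refl
countBelow-act (suc x) (outside ∷ γ) (suc s) rewrite act-suc x outside γ | countBelow-act x γ s = refl

actW-++ : ∀ {m} (u v : List (Fin m)) γ → actW (u ++ v) γ ≡ actW u (actW v γ)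
actW-++ []      v γ = refl
actW-++ (x ∷ u) v γ = cong (act x) (actW-++ u v γ)

actW-map-suc : ∀ {m} (w : List (Fin m)) b (γ : Subset m) → actW (map suc w) (b ∷ γ) ≡ b ∷ actW w γ
actW-map-suc []      b γ = refl
actW-map-suc (x ∷ w) b γ = trans (cong (act (suc x)) (actW-map-suc w b γ)) (act-suc x b (actW w γ))

descent : (m t : ℕ) → List (Fin m)
descent zero    t       = []
descent (suc m) zero    = map suc (descent m zero) ∷ʳ zero
descent (suc m) (suc t) = map suc (descent m t)

countBelow-actW-descent : ∀ m t (γ : Subset m) → countBelow (actW (descent m t) γ) m ≡ (m ∸ t) + countBelow γ t
countBelow-actW-descent zero    zero    []            = refl
countBelow-actW-descent zero    (suc t) []            = refl
countBelow-actW-descent (suc m) zero    (inside ∷ γ)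
  rewrite actW-++ (map suc (descent m zero)) (zero ∷ []) (inside ∷ γ)
        | actW-map-suc (descent m zero) inside γ
        | countBelow-actW-descent m zero γ = refl
countBelow-actW-descent (suc m) zero    (outside ∷ γ)
  rewrite actW-++ (map suc (descent m zero)) (zero ∷ []) (outside ∷ γ)
        | act-zero-outside γ
        | actW-map-suc (descent m zero) inside (removeMin γ)
        | countBelow-actW-descent m zero (removeMin γ) = refl
countBelow-actW-descent (suc m) (suc t) (inside ∷ γ)
  rewrite actW-map-suc (descent m t) inside γ
        | countBelow-actW-descent m t γ = sym (+-suc (m ∸ t) (countBelow γ t))
countBelow-actW-descent (suc m) (suc t) (outside ∷ γ)
  rewrite actW-map-suc (descent m t) outside γ = countBelow-actW-descent m t γ

columnWord : ∀ {m} → Subset m → List (Fin m)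
columnWord []            = []
columnWord (inside ∷ γ)  = map suc (columnWord γ) ∷ʳ zero
columnWord (outside ∷ γ) = map suc (columnWord γ)

removeMin-∅ : ∀ {m} → removeMin (∅col {m}) ≡ ∅col
removeMin-∅ {zero}  = refl
removeMin-∅ {suc m} = cong (outside ∷_) (removeMin-∅ {m})

actW-columnWord : ∀ {m} (γ : Subset m) → actW (columnWord γ) ∅col ≡ γ
actW-columnWord []           = refl
actW-columnWord {suc m} (inside ∷ γ) = begin
  actW (map suc (columnWord γ) ∷ʳ zero) ∅col       ≡⟨ actW-++ (map suc (columnWord γ)) (zero ∷ []) ∅col ⟩
  actW (map suc (columnWord γ)) (act zero ∅col)     ≡⟨ cong (actW (map suc (columnWord γ))) (act-zero-outside ∅col) ⟩
  actW (map suc (columnWord γ)) (inside ∷ removeMin ∅col) ≡⟨ cong (λ δ → actW (map suc (columnWord γ)) (inside ∷ δ)) (removeMin-∅ {m}) ⟩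
  actW (map suc (columnWord γ)) (inside ∷ ∅col)     ≡⟨ actW-map-suc (columnWord γ) inside ∅col ⟩
  inside ∷ actW (columnWord γ) ∅col                 ≡⟨ cong (inside ∷_) (actW-columnWord γ) ⟩
  inside ∷ γ                                        ∎
actW-columnWord (outside ∷ γ) = trans (actW-map-suc (columnWord γ) outside ∅col) (cong (outside ∷_) (actW-columnWord γ))

maxDecreasingBelow≡countBelow-actW : ∀ {n} (w : List (Fin n)) s → maxDecreasingBelow w s ≡ countBelow (actW w ∅col) s
maxDecreasingBelow≡countBelow-actW []      s = sym (countBelow-∅ s)
maxDecreasingBelow≡countBelow-actW (x ∷ w) s = begin
  maxDecreasingBelow (x ∷ w) s                       ≡⟨ maxDecreasingBelow-∷ x w s ⟩
  extend (toℕ x) (maxDecreasingBelow w) s            ≡⟨ extend-cong (toℕ x) (maxDecreasingBelow≡countBelow-actW w) s ⟩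
  extend (toℕ x) (countBelow (actW w ∅col)) s        ≡⟨ countBelow-act x (actW w ∅col) s ⟨
  countBelow (act x (actW w ∅col)) s                 ∎

module _ {n : ℕ} where

  f-++ : (x u : List (Fin n)) → f (x ++ u) ≡ countBelow (actW x (actW u ∅col)) n
  f-++ x u = begin
    f (x ++ u)                                ≡⟨ f≡maxDecreasingBelow (x ++ u) ⟩
    maxDecreasingBelow (x ++ u) n             ≡⟨ maxDecreasingBelow≡countBelow-actW (x ++ u) n ⟩
    countBelow (actW (x ++ u) ∅col) n         ≡⟨ cong (λ γ → countBelow γ n) (actW-++ x u ∅col) ⟩
    countBelow (actW x (actW u ∅col)) n       ∎

  f-descent-++ : (t : ℕ) (u : List (Fin n)) → f (descent n t ++ u) ≡ (n ∸ t) + countBelow (actW u ∅col) t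
  f-descent-++ t u = trans (f-++ (descent n t) u) (countBelow-actW-descent n t (actW u ∅col))

  leftSynCong-f⇔ : (u v : List (Fin n)) → LeftSynCong f u v ⇔ (actW u ∅col ≡ actW v ∅col)
  leftSynCong-f⇔ u v = mk⇔ to from
    where
    to : LeftSynCong f u v → actW u ∅col ≡ actW v ∅col
    to fxu≡fxv = countBelow-injective λ t →
      +-cancelˡ-≡ (n ∸ t) _ _ (trans (sym (f-descent-++ t u)) (trans (fxu≡fxv (descent n t)) (f-descent-++ t v)))
    from : actW u ∅col ≡ actW v ∅col → LeftSynCong f u v
    from u∅≡v∅ x = trans (f-++ x u) (trans (cong (λ γ → countBelow (actW x γ) n) u∅≡v∅) (sym (f-++ x v)))

  synCong-f⇔ : (u v : List (Fin n)) → SynCong f u v ⇔ (u ≡styl v)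
  synCong-f⇔ u v = mk⇔ to from
    where
    actW-via-columnWord : ∀ w γ → actW w γ ≡ actW (w ++ columnWord γ) ∅col
    actW-via-columnWord w γ = trans (cong (actW w) (sym (actW-columnWord γ))) (sym (actW-++ w (columnWord γ) ∅col))
    to : SynCong f u v → u ≡styl v
    to fxuy≡fxvy γ = begin
      actW u γ                          ≡⟨ actW-via-columnWord u γ ⟩
      actW (u ++ columnWord γ) ∅col     ≡⟨ Equivalence.to (leftSynCong-f⇔ (u ++ columnWord γ) (v ++ columnWord γ)) (λ x → fxuy≡fxvy x (columnWord γ)) ⟩
      actW (v ++ columnWord γ) ∅col     ≡⟨ actW-via-columnWord v γ ⟨
      actW v γ                          ∎
    from : u ≡styl v → SynCong f u v
    from u≡v x y = begin
      f (x ++ u ++ y)                              ≡⟨ f-++ x (u ++ y) ⟩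
      countBelow (actW x (actW (u ++ y) ∅col)) n   ≡⟨ cong (λ γ → countBelow (actW x γ) n) (actW-++ u y ∅col) ⟩
      countBelow (actW x (actW u (actW y ∅col))) n ≡⟨ cong (λ γ → countBelow (actW x γ) n) (u≡v (actW y ∅col)) ⟩
      countBelow (actW x (actW v (actW y ∅col))) n ≡⟨ cong (λ γ → countBelow (actW x γ) n) (actW-++ v y ∅col) ⟨
      countBelow (actW x (actW (v ++ y) ∅col)) n   ≡⟨ f-++ x (v ++ y) ⟨
      f (x ++ v ++ y)                              ∎

theorem13p1 : (n : ℕ) →
    ((u v : List (Fin n)) → LeftSynCong f u v ⇔ (actW u ∅col ≡ actW v ∅col))
    × ((u v : List (Fin n)) → SynCong f u v ⇔ (u ≡styl v))
theorem13p1 n = leftSynCong-f⇔ , synCong-f⇔
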